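{- Let $k,n\in\mathbb{N}$ and let $h,t\in\mathbb{Z}_{\ge0}$ with $0\le h\le k-1$ and $1\le t\le F_n$. Then (i) $a_{k(F_{n+1}-1)+hF_n+t+1} = kF_{n+2}-k+1+hF_{n+1}+\lfloor (F_{n+1}+1+t)\varphi\rfloor-\lfloor (F_{n+1}+1)\varphi\rfloor$; (ii) $b_{k(F_{n+1}-1)+hF_n+t+1} = kF_{n+3}+hF_{n+2}-k+t+2+\lfloor (F_{n+1}+1+t)\varphi\rfloor-\lfloor (F_{n+1}+1)\varphi\rfloor$.
   Context: $\varphi=\frac{1+\sqrt5}{2}$. $F_1=F_2=1$, $F_{i+2}=F_{i+1}+F_i$ is the Fibonacci sequence. Let $\sigma$ be the substitution on finite lists over $\{1,2\}$ acting letterwise by $\sigma(1)=2$, $\sigma(2)=2,1$. Let $C_{1,1}=(1)$ and $C_{i+1,1}=\sigma(C_{i,1})$ (so $C_{2,1}=(2)$, $C_{3,1}=(2,1)$, $C_{4,1}=(2,1,2)$, ...). For fixed $k$, let $C_i^{(k)}$ be the concatenation of $k$ copies of $C_{i,1}$, and let $(c_n)_{n\in\mathbb{N}}$ be the infinite sequence obtained by concatenating $C_1^{(k)},C_2^{(k)},C_3^{(k)},\dots$ in this order; let $d_n=c_n+1$. Define $a_n=(k+1)+\sum_{i=1}^{n-1}c_i$ and $b_n=(2k+2)+\sum_{i=1}^{n-1}d_i$ for $n\in\mathbb{N}$. -}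

module Defs where

open import Data.Nat using (ℕ; zero; suc; _+_; _*_; _∸_; _^_; _≤_; _<_)
open import Data.List using (List; []; _∷_; _++_; concatMap; concat; replicate; upTo; map)
open import Data.Product using (_×_)

-- Fibonacci: fib 0 = 0, fib 1 = 1, so F_i = fib i with F_1 = F_2 = 1.
fib : ℕ → ℕ
fib zero = zero
fib (suc zero) = suc zero
fib (suc (suc i)) = fib (suc i) + fib i

data Letter : Set where
  one two : Letter

val : Letter → ℕ
val one = 1
val two = 2

σ₀ : Letter → List Letter
σ₀ one = two ∷ []
σ₀ two = two ∷ one ∷ []

σ : List Letter → List Letter
σ = concatMap σ₀

-- Cw i = C_{i+1,1}  (Cw 0 = C_{1,1} = (1))
Cw : ℕ → List Letter
Cw zero = one ∷ []
Cw (suc i) = σ (Cw i)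

-- Block k i = C^{(k)}_{i+1} : k copies of C_{i+1,1}
Block : ℕ → ℕ → List Letter
Block k i = concat (replicate k (Cw i))

-- nth element (0-based), with default value 0 if out of range
nth : List Letter → ℕ → ℕ
nth [] _ = 0
nth (x ∷ _) zero = val x
nth (_ ∷ xs) (suc j) = nth xs j

-- c k n = c_n (1-based, n ≥ 1) of the infinite concatenation
-- C^{(k)}_1 C^{(k)}_2 C^{(k)}_3 ...  For k ≥ 1 every block is nonempty, so the
-- first n blocks already contain position n and the default is never used.
c : ℕ → ℕ → ℕ
c k n = nth (concat (map (Block k) (upTo n))) (n ∸ 1)

d : ℕ → ℕ → ℕ
d k n = suc (c k n)

sumTo : (ℕ → ℕ) → ℕ → ℕ
sumTo f zero = zero
sumTo f (suc m) = sumTo f m + f (suc m)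

a : ℕ → ℕ → ℕ
a k n = (k + 1) + sumTo (c k) (n ∸ 1)

b : ℕ → ℕ → ℕ
b k n = (2 * k + 2) + sumTo (d k) (n ∸ 1)

-- IsFloorMulφ m q  :⇔  q = ⌊ m φ ⌋ , i.e.  q ≤ m φ < q + 1, with φ = (1+√5)/2.
-- q ≤ mφ  ⇔  2q - m ≤ m√5  ⇔  (2q ∸ m)² ≤ 5 m²
-- mφ < q+1 ⇔ m√5 < 2q + 2 - m ⇔  5 m² < (2q + 2 ∸ m)²
IsFloorMulφ : ℕ → ℕ → Set
IsFloorMulφ m q = ((2 * q ∸ m) ^ 2 ≤ 5 * m ^ 2) × (5 * m ^ 2 < (2 * q + 2 ∸ m) ^ 2)

{-# OPTIONS --safe #-}
-- The N − 1 letters preceding c_N are the blocks C^{(k)}_1, …, C^{(k)}_{n−1}, then h copies of C_{n,1}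
-- and the first t letters of C_{n,1}. As C_{i,1} has length F_i and letter sum F_{i+1}, this gives
-- a_N = k F_{n+2} − k + 1 + h F_{n+1} + s, and b_N likewise, where s is the sum of the first t letters
-- of C_{n,1}; it remains to show s = q₁ − q₂. For i ≥ 2 the prefix sums of C_{i,1} are ⌊(t + 1) φ⌋ − 1,
-- by induction along C_{i+2,1} = C_{i+1,1} C_{i,1} using the shift rule
-- ⌊(F_{i+1} + u) φ⌋ = F_{i+2} + ⌊u φ⌋ for 1 ≤ u < F_{i+2}, a Farey-neighbour argument driven by
-- Cassini's identity. Reading these prefix sums for C_{n+2,1} = C_{n+1,1} C_{n,1} at F_{n+1} + t and at
-- F_{n+1} gives q₁ = F_{n+2} + 1 + s and q₂ = F_{n+2} + 1.
module Submission where

open import Defs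
open import Data.Bool using (T)
open import Data.Integer using (ℤ; +_; _-_) renaming (_+_ to _+ℤ_)
import Data.Integer.Tactic.RingSolver as ℤ-Solver
open import Data.List using (List; []; _∷_; _++_; concat; replicate; upTo; map; take; length; [_]; _∷ʳ_)
open import Data.List.Properties using (length-++; map-++; concat-++; concatMap-++; ++-identityʳ; ++-assoc; upTo-∷ʳ)
open import Data.Nat using (ℕ; zero; suc; _+_; _*_; _∸_; _^_; _≤_; _<_; _≤′_; ≤′-refl; ≤′-step; _≤?_; _≤ᵇ_; z≤n; s≤s)
open import Data.Nat.ListAction using (sum)
open import Data.Nat.ListAction.Properties using (sum-++)
open import Data.Nat.Properties
open import Algebra.Properties.CommutativeSemigroup +-commutativeSemigroup using (xy∙z≈xz∙y)
open import Data.Nat.Tactic.RingSolver using (solve-∀; solve)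
open import Data.Product using (_×_; _,_; ∃; proj₂)
open import Data.Sum using (_⊎_; inj₁; inj₂)
open import Data.Unit using (tt)
open import Function using (_∘_)
open import Relation.Binary.Definitions using (tri<; tri≈; tri>)
open import Relation.Binary.PropositionalEquality using (_≡_; refl; sym; trans; cong; cong₂; subst; subst₂; module ≡-Reasoning)
open import Relation.Nullary using (¬_; yes; no; contradiction)

-- Comparison with multiples of φ

infix 4 _≤_·φ _·φ<_

-- φ is the positive root of x² = x + 1, so for naturals q ≤ m φ iff q² ≤ q m + m².
data _≤_·φ (q m : ℕ) : Set where
  below : q * q ≤ q * m + m * m → q ≤ m ·φ

data _·φ<_ (m q : ℕ) : Set where
  above : q * m + m * m < q * q → m ·φ< q

IsFloorφ : ℕ → ℕ → Set
IsFloorφ m q = q ≤ m ·φ × m ·φ< suc q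

≤·φ⊎·φ< : ∀ q m → q ≤ m ·φ ⊎ m ·φ< q
≤·φ⊎·φ< q m with q * q ≤? q * m + m * m
... | yes q²≤ = inj₁ (below q²≤)
... | no q²≰ = inj₂ (above (≰⇒> q²≰))

≤·φ⇒¬·φ< : ∀ {q m} → q ≤ m ·φ → ¬ (m ·φ< q)
≤·φ⇒¬·φ< (below q²≤) (above q²>) = <⇒≱ q²> q²≤

·φ<⇒≤ : ∀ {m q} → m ·φ< q → m ≤ q
·φ<⇒≤ {m} {q} (above q²>) with m ≤? q
... | yes m≤q = m≤q
... | no m≰q = contradiction (≤-trans (*-monoʳ-≤ q (<⇒≤ (≰⇒> m≰q))) (m≤m+n (q * m) (m * m))) (<⇒≱ q²>)

·φ<-≤-trans : ∀ {m q r} → m ·φ< q → q ≤ r → m ·φ< r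
·φ<-≤-trans {m} {q} mφ<q q≤r with m≤n⇒∃[o]m+o≡n q≤r | mφ<q
... | e , refl | above q²> = above (begin-strict
  (q + e) * m + m * m             ≡⟨ solve (q ∷ e ∷ m ∷ []) ⟩
  (q * m + m * m) + e * m         <⟨ +-monoˡ-< (e * m) q²> ⟩
  q * q + e * m                   ≤⟨ +-monoʳ-≤ (q * q) (*-monoʳ-≤ e (·φ<⇒≤ mφ<q)) ⟩
  q * q + e * q                   ≤⟨ m≤m+n (q * q + e * q) (e * q + e * e) ⟩
  q * q + e * q + (e * q + e * e) ≡⟨ solve (q ∷ e ∷ []) ⟩
  (q + e) * (q + e)               ∎)
  where open ≤-Reasoning

≤·φ-scale : ∀ {q m} d → q ≤ m ·φ → q * d ≤ m * d ·φ
≤·φ-scale {q} {m} d (below q²≤) = below (begin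
  (q * d) * (q * d)                     ≡⟨ solve (q ∷ d ∷ []) ⟩
  (q * q) * (d * d)                     ≤⟨ *-monoˡ-≤ (d * d) q²≤ ⟩
  (q * m + m * m) * (d * d)             ≡⟨ solve (q ∷ m ∷ d ∷ []) ⟩
  (q * d) * (m * d) + (m * d) * (m * d) ∎)
  where open ≤-Reasoning

·φ<-scale : ∀ {m q d} → 1 ≤ d → m ·φ< q → m * d ·φ< q * d
·φ<-scale {m} {q} {suc e} _ (above q²>) = above (begin-strict
  (q * suc e) * (m * suc e) + (m * suc e) * (m * suc e) ≡⟨ solve (q ∷ m ∷ e ∷ []) ⟩
  (q * m + m * m) * (suc e * suc e)                     <⟨ *-monoˡ-< (suc e * suc e) q²> ⟩
  (q * q) * (suc e * suc e)                             ≡⟨ solve (q ∷ e ∷ []) ⟩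
  (q * suc e) * (q * suc e)                             ∎)
  where open ≤-Reasoning

-- Ratios are compared by cross-multiplication: a / b ≤ x / y is written a * y ≤ x * b.
belowφ<aboveφ : ∀ {q m c d} → q ≤ m ·φ → d ·φ< c → 1 ≤ m → q * d < c * m
belowφ<aboveφ {q} {m} {c} {d} q≤mφ dφ<c 1≤m with q * d <? c * m
... | yes qd<cm = qd<cm
... | no qd≮cm = contradiction (·φ<-≤-trans mdφ<cm (≮⇒≥ qd≮cm)) (≤·φ⇒¬·φ< (≤·φ-scale d q≤mφ))
  where
  mdφ<cm : m * d ·φ< c * m
  mdφ<cm = subst (_·φ< c * m) (*-comm d m) (·φ<-scale 1≤m dφ<c)

≤·φ-from-ratio : ∀ {q m a b} → q * b ≤ a * m → a ≤ b ·φ → 1 ≤ b → q ≤ m ·φ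
≤·φ-from-ratio {q} {m} qb≤am a≤bφ 1≤b with ≤·φ⊎·φ< q m
... | inj₁ q≤mφ = q≤mφ
... | inj₂ mφ<q = contradiction qb≤am (<⇒≱ (belowφ<aboveφ a≤bφ mφ<q 1≤b))

·φ<-from-ratio : ∀ {c d x m} → c * m ≤ x * d → d ·φ< c → 1 ≤ m → m ·φ< x
·φ<-from-ratio {x = x} {m} cm≤xd dφ<c 1≤m with ≤·φ⊎·φ< x m
... | inj₁ x≤mφ = contradiction cm≤xd (<⇒≱ (belowφ<aboveφ x≤mφ dφ<c 1≤m))
... | inj₂ mφ<x = mφ<x

isFloorφ-unique : ∀ {m q r} → IsFloorφ m q → IsFloorφ m r → q ≡ r
isFloorφ-unique {q = q} {r} (q≤mφ , mφ<q+1) (r≤mφ , mφ<r+1) with <-cmp q r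
... | tri< q<r _ _ = contradiction (·φ<-≤-trans mφ<q+1 q<r) (≤·φ⇒¬·φ< r≤mφ)
... | tri≈ _ q≡r _ = q≡r
... | tri> _ _ r<q = contradiction (·φ<-≤-trans mφ<r+1 r<q) (≤·φ⇒¬·φ< q≤mφ)

isFloorφ-by-evaluation : ∀ {m q} → T (q * q ≤ᵇ q * m + m * m) → T (suc (suc q * m + m * m) ≤ᵇ suc q * suc q) →
                         IsFloorφ m q
isFloorφ-by-evaluation lo hi = below (≤ᵇ⇒≤ _ _ lo) , above (≤ᵇ⇒≤ _ _ hi)

square : ∀ x → x ^ 2 ≡ x * x
square x = cong (x *_) (*-identityʳ x)

four-norm : ∀ m q x → m + x ≡ 2 * q → 4 * (q * q) + 5 * (m * m) ≡ x * x + 4 * (q * m + m * m)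
four-norm m q x m+x≡2q = begin
  4 * (q * q) + 5 * (m * m)                 ≡⟨ solve (q ∷ m ∷ []) ⟩
  (2 * q) * (2 * q) + 5 * (m * m)           ≡⟨ cong (λ y → y * y + 5 * (m * m)) (sym m+x≡2q) ⟩
  (m + x) * (m + x) + 5 * (m * m)           ≡⟨ solve (m ∷ x ∷ []) ⟩
  x * x + (2 * ((m + x) * m) + 4 * (m * m)) ≡⟨ cong (λ y → x * x + (2 * (y * m) + 4 * (m * m))) m+x≡2q ⟩
  x * x + (2 * ((2 * q) * m) + 4 * (m * m)) ≡⟨ solve (x ∷ q ∷ m ∷ []) ⟩
  x * x + 4 * (q * m + m * m)               ∎
  where open ≡-Reasoning

≤·φ-from-√5 : ∀ m q → (2 * q ∸ m) ^ 2 ≤ 5 * m ^ 2 → q ≤ m ·φ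
≤·φ-from-√5 m q x²≤5m² with m ≤? 2 * q
... | no m≰2q = below (≤-trans (*-monoʳ-≤ q q≤m) (m≤m+n (q * m) (m * m)))
  where
  q≤m : q ≤ m
  q≤m = ≤-trans (m≤m+n q (q + 0)) (<⇒≤ (≰⇒> m≰2q))
... | yes m≤2q = below (*-cancelˡ-≤ 4 (+-cancelʳ-≤ (5 * (m * m)) _ _ (begin
  4 * (q * q) + 5 * (m * m)     ≡⟨ four-norm m q x (m+[n∸m]≡n m≤2q) ⟩
  x * x + 4 * (q * m + m * m)   ≤⟨ +-monoˡ-≤ _ (subst₂ _≤_ (square x) (cong (5 *_) (square m)) x²≤5m²) ⟩
  5 * (m * m) + 4 * (q * m + m * m) ≡⟨ +-comm (5 * (m * m)) _ ⟩
  4 * (q * m + m * m) + 5 * (m * m) ∎)))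
  where
  x = 2 * q ∸ m
  open ≤-Reasoning

·φ<-from-√5 : ∀ m q → 5 * m ^ 2 < (2 * q ∸ m) ^ 2 → m ·φ< q
·φ<-from-√5 m q 5m²<x² with m ≤? 2 * q
... | no m≰2q = contradiction (subst (λ x → 5 * m ^ 2 < x ^ 2) (m≤n⇒m∸n≡0 (<⇒≤ (≰⇒> m≰2q))) 5m²<x²) n≮0
... | yes m≤2q = above (*-cancelˡ-< 4 _ _ (+-cancelʳ-< (5 * (m * m)) _ _ (begin-strict
  4 * (q * m + m * m) + 5 * (m * m) ≡⟨ +-comm _ (5 * (m * m)) ⟩
  5 * (m * m) + 4 * (q * m + m * m) <⟨ +-monoˡ-< _ (subst₂ _<_ (cong (5 *_) (square m)) (square x) 5m²<x²) ⟩
  x * x + 4 * (q * m + m * m)       ≡⟨ four-norm m q x (m+[n∸m]≡n m≤2q) ⟨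
  4 * (q * q) + 5 * (m * m)         ∎)))
  where
  x = 2 * q ∸ m
  open ≤-Reasoning

isFloorMulφ⇒isFloorφ : ∀ {m} q → IsFloorMulφ m q → IsFloorφ m q
isFloorMulφ⇒isFloorφ {m} q (lo , hi) =
  ≤·φ-from-√5 m q lo , ·φ<-from-√5 m (suc q) (subst (λ y → 5 * m ^ 2 < (y ∸ m) ^ 2) 2q+2≡2[q+1] hi)
  where
  2q+2≡2[q+1] : 2 * q + 2 ≡ 2 * suc q
  2q+2≡2[q+1] = solve (q ∷ [])

-- Farey neighbours and Cassini's identity

farey : ∀ a b c d x y → c * b ≡ a * d + 1 → a * y < x * b → x * d < c * y → b + d ≤ y
farey a b c d x y cb≡ad+1 ay<xb xd<cy = +-cancelˡ-≤ (a * d * y) (b + d) y (begin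
  a * d * y + (b + d) ≡⟨ solve (a ∷ b ∷ d ∷ y ∷ []) ⟩
  d * suc (a * y) + b ≤⟨ +-monoˡ-≤ b (*-monoʳ-≤ d ay<xb) ⟩
  d * (x * b) + b     ≡⟨ solve (b ∷ d ∷ x ∷ []) ⟩
  b * suc (x * d)     ≤⟨ *-monoʳ-≤ b xd<cy ⟩
  b * (c * y)         ≡⟨ solve (b ∷ c ∷ y ∷ []) ⟩
  (c * b) * y         ≡⟨ cong (_* y) cb≡ad+1 ⟩
  (a * d + 1) * y     ≡⟨ solve (a ∷ d ∷ y ∷ []) ⟩
  a * d * y + y       ∎)
  where open ≤-Reasoning

module _ {_R_ : ℕ → ℕ → Set} (R-monoʳ : ∀ k {m n} → m R n → (k + m) R (k + n)) where

  mediantˡ : ∀ a b x y → (a * y) R (x * b) → (a * (b + y)) R ((a + x) * b)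
  mediantˡ a b x y ayRxb =
    subst₂ _R_ (sym (*-distribˡ-+ a b y)) (sym (*-distribʳ-+ b a x)) (R-monoʳ (a * b) ayRxb)

  mediantʳ : ∀ c d x y → (x * d) R (c * y) → ((c + x) * d) R (c * (d + y))
  mediantʳ c d x y xdRcy =
    subst₂ _R_ (sym (*-distribʳ-+ d c x)) (sym (*-distribˡ-+ c d y)) (R-monoʳ (c * d) xdRcy)

-- g² − g f − f² = ±1, written as (g + f) f = g² ∓ 1.
data Cassini (g f : ℕ) : Set where
  positive : (g + f) * f + 1 ≡ g * g → Cassini g f
  negative : (g + f) * f ≡ g * g + 1 → Cassini g f

positive-step : ∀ g f → (g + f) * f + 1 ≡ g * g → ((g + f) + g) * g ≡ (g + f) * (g + f) + 1
positive-step g f e = begin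
  ((g + f) + g) * g             ≡⟨ solve (g ∷ f ∷ []) ⟩
  (g + f) * g + g * g           ≡⟨ cong (_+_ ((g + f) * g)) e ⟨
  (g + f) * g + ((g + f) * f + 1) ≡⟨ solve (g ∷ f ∷ []) ⟩
  (g + f) * (g + f) + 1         ∎
  where open ≡-Reasoning

negative-step : ∀ g f → (g + f) * f ≡ g * g + 1 → ((g + f) + g) * g + 1 ≡ (g + f) * (g + f)
negative-step g f e = begin
  ((g + f) + g) * g + 1         ≡⟨ solve (g ∷ f ∷ []) ⟩
  (g + f) * g + (g * g + 1)     ≡⟨ cong (_+_ ((g + f) * g)) e ⟨
  (g + f) * g + (g + f) * f     ≡⟨ *-distribˡ-+ (g + f) g f ⟨
  (g + f) * (g + f)             ∎
  where open ≡-Reasoning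

cassini-step : ∀ {g f} → Cassini g f → Cassini (g + f) g
cassini-step {g} {f} (positive e) = negative (positive-step g f e)
cassini-step {g} {f} (negative e) = positive (negative-step g f e)

cassini : ∀ i → Cassini (fib (suc i)) (fib i)
cassini zero = positive refl
cassini (suc i) = cassini-step (cassini i)

fib-pos : ∀ i → 1 ≤ fib (suc i)
fib-pos zero = ≤-refl
fib-pos (suc i) = ≤-trans (fib-pos i) (m≤m+n (fib (suc i)) (fib i))

positive⇒·φ< : ∀ {g f} → (g + f) * f + 1 ≡ g * g → f ·φ< g
positive⇒·φ< {g} {f} e = above (subst₂ _<_ (*-distribʳ-+ f g f) e (m<m+n _ (s≤s z≤n)))

negative⇒≤·φ : ∀ {g f} → (g + f) * f ≡ g * g + 1 → g ≤ f ·φ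
negative⇒≤·φ {g} {f} e = below (subst (g * g ≤_) (trans (sym e) (*-distribʳ-+ f g f)) (m≤m+n (g * g) 1))

-- With h = g + f and l = h + g, Cassini places g / f, h / g, l / h alternately around φ, consecutive
-- ones being Farey neighbours. Of the two bounds on the shifted ratios (h + p) / (g + u) and
-- (h + p + 1) / (g + u), one is a mediant inequality; the other holds because u < h leaves no room
-- strictly between neighbours.
isFloorφ-shift : ∀ {g f u p} → Cassini g f → 1 ≤ f → 1 ≤ g → 1 ≤ u → u < g + f →
                 IsFloorφ u p → IsFloorφ (g + u) ((g + f) + p)
isFloorφ-shift {g} {f} {u} {p} (positive e) _ 1≤g 1≤u u<h (p≤uφ , uφ<p+1) = lower , upper
  where
  h = g + f
  l = h + g
  lg≡hh+1 : l * g ≡ h * h + 1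
  lg≡hh+1 = positive-step g f e
  h≤gφ : h ≤ g ·φ
  h≤gφ = negative⇒≤·φ lg≡hh+1
  fφ<g : f ·φ< g
  fφ<g = positive⇒·φ< e
  hφ<l : h ·φ< l
  hφ<l = positive⇒·φ< (negative-step h g lg≡hh+1)
  pg≤hu : p * g ≤ h * u
  pg≤hu with p * g ≤? h * u
  ... | yes pg≤hu = pg≤hu
  ... | no pg≰hu = contradiction
    (farey h g g f p u (sym e) (≰⇒> pg≰hu) (belowφ<aboveφ p≤uφ fφ<g 1≤u)) (<⇒≱ u<h)
  lower : h + p ≤ g + u ·φ
  lower = ≤·φ-from-ratio (mediantʳ +-monoʳ-≤ h g p u pg≤hu) h≤gφ 1≤g
  upper : g + u ·φ< suc (h + p)
  upper with ≤·φ⊎·φ< (h + suc p) (g + u)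
  ... | inj₂ [g+u]φ< = subst (g + u ·φ<_) (+-suc h p) [g+u]φ<
  ... | inj₁ ≤[g+u]φ = contradiction (+-cancelˡ-≤ g h u (farey h g l h (h + suc p) (g + u) lg≡hh+1
          (mediantˡ +-monoʳ-< h g (suc p) u (belowφ<aboveφ h≤gφ uφ<p+1 1≤g))
          (belowφ<aboveφ ≤[g+u]φ hφ<l (≤-trans 1≤u (m≤n+m u g)))))
        (<⇒≱ u<h)
isFloorφ-shift {g} {f} {u} {p} (negative e) 1≤f _ 1≤u u<h (p≤uφ , uφ<p+1) = lower , upper
  where
  h = g + f
  l = h + g
  lg+1≡hh : l * g + 1 ≡ h * h
  lg+1≡hh = negative-step g f e
  gφ<h : g ·φ< h
  gφ<h = positive⇒·φ< lg+1≡hh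
  g≤fφ : g ≤ f ·φ
  g≤fφ = negative⇒≤·φ e
  l≤hφ : l ≤ h ·φ
  l≤hφ = negative⇒≤·φ (positive-step h g lg+1≡hh)
  hu≤[p+1]g : h * u ≤ suc p * g
  hu≤[p+1]g with h * u ≤? suc p * g
  ... | yes hu≤[p+1]g = hu≤[p+1]g
  ... | no hu≰[p+1]g = contradiction
    (farey g f h g (suc p) u e (belowφ<aboveφ g≤fφ uφ<p+1 1≤f) (≰⇒> hu≰[p+1]g))
    (<⇒≱ (subst (u <_) (+-comm g f) u<h))
  upper : g + u ·φ< suc (h + p)
  upper = subst (g + u ·φ<_) (+-suc h p)
    (·φ<-from-ratio (mediantˡ +-monoʳ-≤ h g (suc p) u hu≤[p+1]g) gφ<h (≤-trans 1≤u (m≤n+m u g)))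
  lower : h + p ≤ g + u ·φ
  lower with ≤·φ⊎·φ< (h + p) (g + u)
  ... | inj₁ ≤[g+u]φ = ≤[g+u]φ
  ... | inj₂ [g+u]φ< = contradiction (+-cancelˡ-≤ g h u (subst (_≤ g + u) (+-comm h g)
          (farey l h h g (h + p) (g + u) (sym lg+1≡hh)
            (belowφ<aboveφ l≤hφ [g+u]φ< (≤-trans 1≤f (m≤n+m f g)))
            (mediantʳ +-monoʳ-< h g p u (belowφ<aboveφ p≤uφ gφ<h 1≤u)))))
        (<⇒≱ u<h)

-- The Fibonacci word

weight : List Letter → ℕ
weight w = sum (map val w)

weight-++ : ∀ v w → weight (v ++ w) ≡ weight v + weight w
weight-++ v w = trans (cong sum (map-++ val v w)) (sum-++ (map val v) (map val w))

take-++-≤ : ∀ {A : Set} {t} (xs ys : List A) → t ≤ length xs → take t (xs ++ ys) ≡ take t xs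
take-++-≤ {t = zero} xs ys _ = refl
take-++-≤ {t = suc t} (x ∷ xs) ys (s≤s t≤) = cong (x ∷_) (take-++-≤ xs ys t≤)

take-length-++ : ∀ {A : Set} (xs ys : List A) r → take (length xs + r) (xs ++ ys) ≡ xs ++ take r ys
take-length-++ [] ys r = refl
take-length-++ (x ∷ xs) ys r = cong (x ∷_) (take-length-++ xs ys r)

weight-take-length-++ : ∀ v w r → weight (take (length v + r) (v ++ w)) ≡ weight v + weight (take r w)
weight-take-length-++ v w r = trans (cong weight (take-length-++ v w r)) (weight-++ v (take r w))

nth-++ : ∀ v w {i} → i < length v → nth (v ++ w) i ≡ nth v i
nth-++ (x ∷ v) w {zero} _ = refl
nth-++ (x ∷ v) w {suc i} (s≤s i<) = nth-++ v w i<

weight-take-suc : ∀ w {t} → t < length w → weight (take (suc t) w) ≡ weight (take t w) + nth w t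
weight-take-suc (x ∷ w) {zero} _ = +-identityʳ (val x)
weight-take-suc (x ∷ w) {suc t} (s≤s t<) =
  trans (cong (_+_ (val x)) (weight-take-suc w t<)) (sym (+-assoc (val x) _ _))

length-σ : ∀ w → length (σ w) ≡ weight w
length-σ [] = refl
length-σ (one ∷ w) = cong suc (length-σ w)
length-σ (two ∷ w) = cong (_+_ 2) (length-σ w)

weight-σ : ∀ w → weight (σ w) ≡ weight w + length w
weight-σ [] = refl
weight-σ (one ∷ w) = trans (cong (_+_ 2) (weight-σ w)) (cong (_+_ 1) (sym (+-suc (weight w) (length w))))
weight-σ (two ∷ w) = trans (cong (_+_ 3) (weight-σ w)) (cong (_+_ 2) (sym (+-suc (weight w) (length w))))

length-Cw : ∀ i → length (Cw i) ≡ fib (suc i)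
weight-Cw : ∀ i → weight (Cw i) ≡ fib (suc (suc i))
length-Cw zero = refl
length-Cw (suc i) = trans (length-σ (Cw i)) (weight-Cw i)
weight-Cw zero = refl
weight-Cw (suc i) = trans (weight-σ (Cw i)) (cong₂ _+_ (weight-Cw i) (length-Cw i))

Cw-suc-suc : ∀ i → Cw (suc (suc i)) ≡ Cw (suc i) ++ Cw i
Cw-suc-suc zero = refl
Cw-suc-suc (suc i) = trans (cong σ (Cw-suc-suc i)) (concatMap-++ σ₀ (Cw (suc i)) (Cw i))

-- w is a prefix of the characteristic word of slope φ − 1, written over the letters 1 and 2.
Mechanical : List Letter → Set
Mechanical w = ∀ t → t ≤ length w → IsFloorφ (suc t) (suc (weight (take t w)))

mechanical-++ : ∀ {v w} → Cassini (length v) (length w) → 1 ≤ length w → 2 ≤ length v →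
                weight v ≡ length v + length w → Mechanical v → Mechanical w → Mechanical (v ++ w)
mechanical-++ {v} {w} cas 1≤f 2≤g weight-v mech-v mech-w t t≤ with ≤-total t (length v)
... | inj₁ t≤g = subst (IsFloorφ (suc t) ∘ suc ∘ weight) (sym (take-++-≤ v w t≤g)) (mech-v t t≤g)
... | inj₂ g≤t with m≤n⇒∃[o]m+o≡n g≤t
...   | s , refl = subst₂ IsFloorφ (+-suc g s) prefix-weight
        (isFloorφ-shift cas 1≤f (≤-trans (s≤s z≤n) 2≤g) (s≤s z≤n) (+-mono-≤ 2≤g s≤f) (mech-w s s≤f))
  where
  g = length v
  f = length w
  s≤f : s ≤ f
  s≤f = +-cancelˡ-≤ g s f (subst (g + s ≤_) (length-++ v) t≤)
  prefix-weight : (g + f) + suc (weight (take s w)) ≡ suc (weight (take (g + s) (v ++ w)))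
  prefix-weight = begin
    (g + f) + suc (weight (take s w))    ≡⟨ +-suc (g + f) _ ⟩
    suc ((g + f) + weight (take s w))    ≡⟨ cong (λ x → suc (x + weight (take s w))) weight-v ⟨
    suc (weight v + weight (take s w))   ≡⟨ cong suc (weight-take-length-++ v w s) ⟨
    suc (weight (take (g + s) (v ++ w))) ∎
    where open ≡-Reasoning

mechanical-Cw : ∀ i → Mechanical (Cw (suc i)) × Mechanical (Cw (suc (suc i)))
mechanical-Cw zero = mechanical-Cw₁ , mechanical-Cw₂
  where
  mechanical-Cw₁ : Mechanical (Cw 1)
  mechanical-Cw₁ zero _ = isFloorφ-by-evaluation tt tt
  mechanical-Cw₁ (suc zero) _ = isFloorφ-by-evaluation tt tt
  mechanical-Cw₁ (suc (suc _)) (s≤s ())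
  mechanical-Cw₂ : Mechanical (Cw 2)
  mechanical-Cw₂ zero _ = isFloorφ-by-evaluation tt tt
  mechanical-Cw₂ (suc zero) _ = isFloorφ-by-evaluation tt tt
  mechanical-Cw₂ (suc (suc zero)) _ = isFloorφ-by-evaluation tt tt
  mechanical-Cw₂ (suc (suc (suc _))) (s≤s (s≤s ()))
mechanical-Cw (suc i) with mechanical-Cw i
... | mech₁ , mech₂ = mech₂ , subst Mechanical (sym (Cw-suc-suc (suc i)))
        (mechanical-++ cassini′ 1≤f 2≤g weight-v mech₂ mech₁)
  where
  v = Cw (suc (suc i))
  w = Cw (suc i)
  cassini′ : Cassini (length v) (length w)
  cassini′ = subst₂ Cassini (sym (length-Cw (suc (suc i)))) (sym (length-Cw (suc i))) (cassini (suc (suc i)))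
  1≤f : 1 ≤ length w
  1≤f = subst (1 ≤_) (sym (length-Cw (suc i))) (fib-pos (suc i))
  2≤g : 2 ≤ length v
  2≤g = subst (2 ≤_) (sym (length-Cw (suc (suc i)))) (+-mono-≤ (fib-pos (suc i)) (fib-pos i))
  weight-v : weight v ≡ length v + length w
  weight-v = trans (weight-Cw (suc (suc i))) (sym (cong₂ _+_ (length-Cw (suc (suc i))) (length-Cw (suc i))))

suc-+ : ∀ m n → suc (m + n) ≡ m + 1 + n
suc-+ m n = sym (trans (+-assoc m 1 n) (+-suc m n))

isFloorφ-after-fib : ∀ i {t} → t ≤ fib (suc i) →
  IsFloorφ (fib (suc (suc i)) + 1 + t) (fib (suc (suc (suc i))) + 1 + weight (take t (Cw i)))
isFloorφ-after-fib i {t} t≤ =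
  subst₂ IsFloorφ (suc-+ F₂ t) (trans (cong suc prefix-weight) (suc-+ F₃ _)) (proj₂ (mechanical-Cw i) (F₂ + t) F₂+t≤)
  where
  F₂ = fib (suc (suc i))
  F₃ = fib (suc (suc (suc i)))
  F₂+t≤ : F₂ + t ≤ length (Cw (suc (suc i)))
  F₂+t≤ = subst (F₂ + t ≤_) (sym (length-Cw (suc (suc i)))) (+-monoʳ-≤ F₂ t≤)
  prefix-weight : weight (take (F₂ + t) (Cw (suc (suc i)))) ≡ F₃ + weight (take t (Cw i))
  prefix-weight = begin
    weight (take (F₂ + t) (Cw (suc (suc i))))                     ≡⟨ cong (λ n → weight (take (n + t) (Cw (suc (suc i))))) (length-Cw (suc i)) ⟨
    weight (take (length (Cw (suc i)) + t) (Cw (suc (suc i))))    ≡⟨ cong (weight ∘ take (length (Cw (suc i)) + t)) (Cw-suc-suc i) ⟩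
    weight (take (length (Cw (suc i)) + t) (Cw (suc i) ++ Cw i))  ≡⟨ weight-take-length-++ (Cw (suc i)) (Cw i) t ⟩
    weight (Cw (suc i)) + weight (take t (Cw i))                   ≡⟨ cong (_+ weight (take t (Cw i))) (weight-Cw (suc i)) ⟩
    F₃ + weight (take t (Cw i))                                    ∎
    where open ≡-Reasoning

-- The sequence c

length-concat-replicate : ∀ {A : Set} k (w : List A) → length (concat (replicate k w)) ≡ k * length w
length-concat-replicate zero w = refl
length-concat-replicate (suc k) w = trans (length-++ w) (cong (_+_ (length w)) (length-concat-replicate k w))

weight-concat-replicate : ∀ k w → weight (concat (replicate k w)) ≡ k * weight w
weight-concat-replicate zero w = refl
weight-concat-replicate (suc k) w = trans (weight-++ w _) (cong (_+_ (weight w)) (weight-concat-replicate k w))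

take-concat-replicate : ∀ {A : Set} {k h t} (w : List A) → h < k → t ≤ length w →
                        take (h * length w + t) (concat (replicate k w)) ≡ concat (replicate h w) ++ take t w
take-concat-replicate {k = suc k} {zero} w _ t≤ = take-++-≤ w _ t≤
take-concat-replicate {k = suc k} {suc h} {t} w (s≤s h<k) t≤ = begin
  take ((length w + h * length w) + t) (w ++ R)   ≡⟨ cong (λ n → take n (w ++ R)) (+-assoc (length w) _ t) ⟩
  take (length w + (h * length w + t)) (w ++ R)   ≡⟨ take-length-++ w R _ ⟩
  w ++ take (h * length w + t) R                  ≡⟨ cong (w ++_) (take-concat-replicate w h<k t≤) ⟩
  w ++ (concat (replicate h w) ++ take t w)       ≡⟨ ++-assoc w _ _ ⟨
  (w ++ concat (replicate h w)) ++ take t w       ∎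
  where
  R = concat (replicate k w)
  open ≡-Reasoning

length-Block : ∀ k i → length (Block k i) ≡ k * fib (suc i)
length-Block k i = trans (length-concat-replicate k (Cw i)) (cong (k *_) (length-Cw i))

weight-Block : ∀ k i → weight (Block k i) ≡ k * fib (suc (suc i))
weight-Block k i = trans (weight-concat-replicate k (Cw i)) (cong (k *_) (weight-Cw i))

blocks : ℕ → ℕ → List Letter
blocks k M = concat (map (Block k) (upTo M))

blocks-suc : ∀ k M → blocks k (suc M) ≡ blocks k M ++ Block k M
blocks-suc k M = begin
  concat (map (Block k) (upTo (suc M)))         ≡⟨ cong (concat ∘ map (Block k)) (upTo-∷ʳ M) ⟨
  concat (map (Block k) (upTo M ∷ʳ M))          ≡⟨ cong concat (map-++ (Block k) (upTo M) [ M ]) ⟩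
  concat (map (Block k) (upTo M) ∷ʳ Block k M)  ≡⟨ concat-++ (map (Block k) (upTo M)) [ Block k M ] ⟨
  blocks k M ++ (Block k M ++ [])               ≡⟨ cong (blocks k M ++_) (++-identityʳ (Block k M)) ⟩
  blocks k M ++ Block k M                       ∎
  where open ≡-Reasoning

blocks-prefix : ∀ k {M M′} → M ≤′ M′ → ∃ λ r → blocks k M′ ≡ blocks k M ++ r
blocks-prefix k ≤′-refl = [] , sym (++-identityʳ _)
blocks-prefix k (≤′-step {M′} M≤′M′) with blocks-prefix k M≤′M′
... | r , eq = r ++ Block k M′ ,
  trans (blocks-suc k M′) (trans (cong (_++ Block k M′) eq) (++-assoc _ r (Block k M′)))

length-blocks : ∀ k M → length (blocks k M) + k ≡ k * fib (suc (suc M))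
length-blocks k zero = sym (*-identityʳ k)
length-blocks k (suc M) = begin
  length (blocks k (suc M)) + k                    ≡⟨ cong ((_+ k) ∘ length) (blocks-suc k M) ⟩
  length (blocks k M ++ Block k M) + k             ≡⟨ cong (_+ k) (length-++ (blocks k M)) ⟩
  length (blocks k M) + length (Block k M) + k     ≡⟨ xy∙z≈xz∙y (length (blocks k M)) _ k ⟩
  length (blocks k M) + k + length (Block k M)     ≡⟨ cong₂ _+_ (length-blocks k M) (length-Block k M) ⟩
  k * fib (suc (suc M)) + k * fib (suc M)          ≡⟨ *-distribˡ-+ k (fib (suc (suc M))) (fib (suc M)) ⟨
  k * fib (suc (suc (suc M)))                      ∎
  where open ≡-Reasoning

weight-blocks : ∀ k M → weight (blocks k M) + (k + k) ≡ k * fib (suc (suc (suc M)))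
weight-blocks k zero = sym (trans (*-suc k 1) (cong (_+_ k) (*-identityʳ k)))
weight-blocks k (suc M) = begin
  weight (blocks k (suc M)) + (k + k)                 ≡⟨ cong ((_+ (k + k)) ∘ weight) (blocks-suc k M) ⟩
  weight (blocks k M ++ Block k M) + (k + k)          ≡⟨ cong (_+ (k + k)) (weight-++ (blocks k M) _) ⟩
  weight (blocks k M) + weight (Block k M) + (k + k)  ≡⟨ xy∙z≈xz∙y (weight (blocks k M)) _ (k + k) ⟩
  weight (blocks k M) + (k + k) + weight (Block k M)  ≡⟨ cong₂ _+_ (weight-blocks k M) (weight-Block k M) ⟩
  k * fib (suc (suc (suc M))) + k * fib (suc (suc M)) ≡⟨ *-distribˡ-+ k (fib (suc (suc (suc M)))) (fib (suc (suc M))) ⟨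
  k * fib (suc (suc (suc (suc M))))                   ∎
  where open ≡-Reasoning

length-blocks-≥ : ∀ {k} → 1 ≤ k → ∀ M → M ≤ length (blocks k M)
length-blocks-≥ 1≤k zero = z≤n
length-blocks-≥ {k} 1≤k (suc M) = begin
  suc M                                    ≡⟨ +-comm 1 M ⟩
  M + 1                                    ≤⟨ +-mono-≤ (length-blocks-≥ 1≤k M) 1≤|Block| ⟩
  length (blocks k M) + length (Block k M) ≡⟨ length-++ (blocks k M) ⟨
  length (blocks k M ++ Block k M)         ≡⟨ cong length (blocks-suc k M) ⟨
  length (blocks k (suc M))                ∎
  where
  1≤|Block| : 1 ≤ length (Block k M)
  1≤|Block| = subst (1 ≤_) (sym (length-Block k M)) (*-mono-≤ 1≤k (fib-pos M))
  open ≤-Reasoning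

c-as-nth : ∀ {k i} → 1 ≤ k → ∀ M → i < length (blocks k M) → c k (suc i) ≡ nth (blocks k M) i
c-as-nth {k} {i} 1≤k M i< with ≤-total (suc i) M
... | inj₁ i<M with blocks-prefix k (≤⇒≤′ i<M)
...   | r , eq = trans (sym (nth-++ (blocks k (suc i)) r (length-blocks-≥ 1≤k (suc i)))) (cong (λ w → nth w i) (sym eq))
c-as-nth {k} {i} 1≤k M i< | inj₂ M≤i+1 with blocks-prefix k (≤⇒≤′ M≤i+1)
...   | r , eq = trans (cong (λ w → nth w i) eq) (nth-++ (blocks k M) r i<)

sumTo-c : ∀ {k} → 1 ≤ k → ∀ M m → m ≤ length (blocks k M) → sumTo (c k) m ≡ weight (take m (blocks k M))
sumTo-c _ M zero _ = refl
sumTo-c {k} 1≤k M (suc m) m< = begin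
  sumTo (c k) m + c k (suc m)                        ≡⟨ cong₂ _+_ (sumTo-c 1≤k M m (<⇒≤ m<)) (c-as-nth 1≤k M m<) ⟩
  weight (take m (blocks k M)) + nth (blocks k M) m  ≡⟨ weight-take-suc (blocks k M) m< ⟨
  weight (take (suc m) (blocks k M))                 ∎
  where open ≡-Reasoning

sumTo-d : ∀ k m → sumTo (d k) m ≡ m + sumTo (c k) m
sumTo-d k zero = refl
sumTo-d k (suc m) = trans (cong (_+ d k (suc m)) (sumTo-d k m))
  (trans (+-suc (m + sumTo (c k) m) (c k (suc m))) (cong suc (+-assoc m _ _)))

sumTo-c-inside-block : ∀ {k h t} M → 1 ≤ k → h < k → t ≤ fib (suc M) →
  sumTo (c k) (length (blocks k M) + (h * fib (suc M) + t))
    ≡ weight (blocks k M) + (h * fib (suc (suc M)) + weight (take t (Cw M)))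
sumTo-c-inside-block {k} {h} {t} M 1≤k h<k t≤F = begin
  sumTo (c k) (L + (h * F₁ + t))                              ≡⟨ sumTo-c 1≤k (suc M) _ within ⟩
  weight (take (L + (h * F₁ + t)) (blocks k (suc M)))         ≡⟨ cong (weight ∘ take (L + (h * F₁ + t))) (blocks-suc k M) ⟩
  weight (take (L + (h * F₁ + t)) (blocks k M ++ Block k M))  ≡⟨ weight-take-length-++ (blocks k M) (Block k M) _ ⟩
  W + weight (take (h * F₁ + t) (Block k M))                  ≡⟨ cong (λ n → W + weight (take (h * n + t) (Block k M))) (length-Cw M) ⟨
  W + weight (take (h * length (Cw M) + t) (Block k M))       ≡⟨ cong (λ w → W + weight w) (take-concat-replicate (Cw M) h<k t≤|Cw|) ⟩
  W + weight (Block h M ++ take t (Cw M))                     ≡⟨ cong (_+_ W) (weight-++ (Block h M) _) ⟩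
  W + (weight (Block h M) + weight (take t (Cw M)))           ≡⟨ cong (λ n → W + (n + weight (take t (Cw M)))) (weight-Block h M) ⟩
  W + (h * fib (suc (suc M)) + weight (take t (Cw M)))        ∎
  where
  L = length (blocks k M)
  W = weight (blocks k M)
  F₁ = fib (suc M)
  t≤|Cw| : t ≤ length (Cw M)
  t≤|Cw| = subst (t ≤_) (sym (length-Cw M)) t≤F
  within : L + (h * F₁ + t) ≤ length (blocks k (suc M))
  within = begin
    L + (h * F₁ + t)                  ≤⟨ +-monoʳ-≤ L (+-monoʳ-≤ (h * F₁) t≤F) ⟩
    L + (h * F₁ + F₁)                 ≡⟨ cong (_+_ L) (+-comm (h * F₁) F₁) ⟩
    L + suc h * F₁                    ≤⟨ +-monoʳ-≤ L (*-monoˡ-≤ F₁ h<k) ⟩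
    L + k * F₁                        ≡⟨ cong (_+_ L) (length-Block k M) ⟨
    L + length (Block k M)            ≡⟨ length-++ (blocks k M) ⟨
    length (blocks k M ++ Block k M)  ≡⟨ cong length (blocks-suc k M) ⟨
    length (blocks k (suc M))         ∎
    where open ≤-Reasoning
  open ≡-Reasoning

length-blocks-∸ : ∀ k M → length (blocks k M) ≡ k * (fib (suc (suc M)) ∸ 1)
length-blocks-∸ k M = begin
  length (blocks k M)          ≡⟨ m+n∸n≡m (length (blocks k M)) k ⟨
  length (blocks k M) + k ∸ k  ≡⟨ cong (_∸ k) (length-blocks k M) ⟩
  k * F₂ ∸ k                   ≡⟨ cong (k * F₂ ∸_) (*-identityʳ k) ⟨
  k * F₂ ∸ k * 1               ≡⟨ *-distribˡ-∸ k F₂ 1 ⟨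
  k * (F₂ ∸ 1)                 ∎
  where
  F₂ = fib (suc (suc M))
  open ≡-Reasoning

-- ℤ addition computes on naturals: + m +ℤ + n reduces to + (m + n), so ℕ sums meet ℤ ring identities.
cancel-in-ℤ : ∀ {x k q z} → x + k + q ≡ z → + x ≡ + z - + k - + q
cancel-in-ℤ {x} {k} {q} x+k+q≡z = trans (add-subtract (+ x) (+ k) (+ q)) (cong (λ n → + n - + k - + q) x+k+q≡z)
  where
  add-subtract : ∀ (x k q : ℤ) → x ≡ x +ℤ k +ℤ q - k - q
  add-subtract = ℤ-Solver.solve-∀

module _ {k h t : ℕ} (M : ℕ) (1≤k : 1 ≤ k) (h<k : h < k) (t≤F : t ≤ fib (suc M)) where
  private
    F₁ = fib (suc M)
    F₂ = fib (suc (suc M))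
    F₃ = fib (suc (suc (suc M)))
    L = length (blocks k M)
    W = weight (blocks k M)
    S = weight (take t (Cw M))
    N-1 = k * (F₂ ∸ 1) + h * F₁ + t

    N-1≡ : N-1 ≡ L + (h * F₁ + t)
    N-1≡ = trans (cong (λ x → x + h * F₁ + t) (sym (length-blocks-∸ k M))) (+-assoc L (h * F₁) t)

    sumTo-c-N-1 : sumTo (c k) N-1 ≡ W + (h * F₂ + S)
    sumTo-c-N-1 = trans (cong (sumTo (c k)) N-1≡) (sumTo-c-inside-block M 1≤k h<k t≤F)

  a-formula : + a k (N-1 + 1) ≡ + (k * F₃) - + k +ℤ + 1 +ℤ + (h * F₂) +ℤ + (F₃ + 1 + S) - + (F₃ + 1)
  a-formula = trans (cancel-in-ℤ in-ℕ) (move-k (+ (k * F₃)) (+ k) (+ (h * F₂)) (+ (F₃ + 1 + S)) (+ (F₃ + 1)))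
    where
    rearrange : ∀ k W H S F → k + 1 + (W + (H + S)) + k + (F + 1) ≡ W + (k + k) + 1 + H + (F + 1 + S)
    rearrange = solve-∀
    in-ℕ : a k (N-1 + 1) + k + (F₃ + 1) ≡ k * F₃ + 1 + h * F₂ + (F₃ + 1 + S)
    in-ℕ = begin
      a k (N-1 + 1) + k + (F₃ + 1)                 ≡⟨ cong (λ n → k + 1 + sumTo (c k) n + k + (F₃ + 1)) (m+n∸n≡m N-1 1) ⟩
      k + 1 + sumTo (c k) N-1 + k + (F₃ + 1)       ≡⟨ cong (λ x → k + 1 + x + k + (F₃ + 1)) sumTo-c-N-1 ⟩
      k + 1 + (W + (h * F₂ + S)) + k + (F₃ + 1)  ≡⟨ rearrange k W (h * F₂) S F₃ ⟩
      W + (k + k) + 1 + h * F₂ + (F₃ + 1 + S)    ≡⟨ cong (λ x → x + 1 + h * F₂ + (F₃ + 1 + S)) (weight-blocks k M) ⟩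
      k * F₃ + 1 + h * F₂ + (F₃ + 1 + S)         ∎
      where open ≡-Reasoning
    move-k : ∀ (X K H Q₁ Q₂ : ℤ) → X +ℤ + 1 +ℤ H +ℤ Q₁ - K - Q₂ ≡ X - K +ℤ + 1 +ℤ H +ℤ Q₁ - Q₂
    move-k = ℤ-Solver.solve-∀

  b-formula : + b k (N-1 + 1) ≡ + (k * (F₃ + F₂)) +ℤ + (h * F₃) - + k +ℤ + t +ℤ + 2 +ℤ + (F₃ + 1 + S) - + (F₃ + 1)
  b-formula = trans (cancel-in-ℤ in-ℕ)
    (move-k (+ (k * (F₃ + F₂))) (+ (h * F₃)) (+ k) (+ t) (+ (F₃ + 1 + S)) (+ (F₃ + 1)))
    where
    rearrange : ∀ k L W H₁ H₂ t S F → 2 * k + 2 + (L + (H₁ + t) + (W + (H₂ + S))) + k + (F + 1)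
                                       ≡ W + (k + k) + (L + k) + (H₂ + H₁) + t + 2 + (F + 1 + S)
    rearrange = solve-∀
    k[F₃+F₂] : W + (k + k) + (L + k) ≡ k * (F₃ + F₂)
    k[F₃+F₂] = trans (cong₂ _+_ (weight-blocks k M) (length-blocks k M)) (sym (*-distribˡ-+ k F₃ F₂))
    in-ℕ : b k (N-1 + 1) + k + (F₃ + 1) ≡ k * (F₃ + F₂) + h * F₃ + t + 2 + (F₃ + 1 + S)
    in-ℕ = begin
      b k (N-1 + 1) + k + (F₃ + 1)                       ≡⟨ cong (λ n → 2 * k + 2 + sumTo (d k) n + k + (F₃ + 1)) (m+n∸n≡m N-1 1) ⟩
      2 * k + 2 + sumTo (d k) N-1 + k + (F₃ + 1)         ≡⟨ cong (λ x → 2 * k + 2 + x + k + (F₃ + 1)) (sumTo-d k N-1) ⟩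
      2 * k + 2 + (N-1 + sumTo (c k) N-1) + k + (F₃ + 1)   ≡⟨ cong₂ (λ x y → 2 * k + 2 + (x + y) + k + (F₃ + 1)) N-1≡ sumTo-c-N-1 ⟩
      2 * k + 2 + (L + (h * F₁ + t) + (W + (h * F₂ + S))) + k + (F₃ + 1)
                                                       ≡⟨ rearrange k L W (h * F₁) (h * F₂) t S F₃ ⟩
      W + (k + k) + (L + k) + (h * F₂ + h * F₁) + t + 2 + (F₃ + 1 + S)
                                                       ≡⟨ cong₂ (λ x y → x + y + t + 2 + (F₃ + 1 + S)) k[F₃+F₂] (sym (*-distribˡ-+ h F₂ F₁)) ⟩
      k * (F₃ + F₂) + h * F₃ + t + 2 + (F₃ + 1 + S)    ∎
      where open ≡-Reasoning
    move-k : ∀ (X Y K T Q₁ Q₂ : ℤ) → X +ℤ Y +ℤ T +ℤ + 2 +ℤ Q₁ - K - Q₂ ≡ X +ℤ Y - K +ℤ T +ℤ + 2 +ℤ Q₁ - Q₂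
    move-k = ℤ-Solver.solve-∀

theorem5p1 : (k n h t : ℕ) → 1 ≤ k → 1 ≤ n → h < k → 1 ≤ t → t ≤ fib n →
    (q₁ q₂ : ℕ) → IsFloorMulφ (fib (n + 1) + 1 + t) q₁ → IsFloorMulφ (fib (n + 1) + 1) q₂ →
    let N = k * (fib (n + 1) ∸ 1) + h * fib n + t + 1 in
    (+ a k N ≡ + (k * fib (n + 2)) - + k +ℤ + 1 +ℤ + (h * fib (n + 1)) +ℤ + q₁ - + q₂)
    × (+ b k N ≡ + (k * fib (n + 3)) +ℤ + (h * fib (n + 2)) - + k +ℤ + t +ℤ + 2 +ℤ + q₁ - + q₂)
-- n = 0 is refuted by 1 ≤ n.
theorem5p1 k (suc M) h t 1≤k _ h<k _ t≤F q₁ q₂ φ-floor₁ φ-floor₂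
  rewrite +-comm M 1 | +-comm M 2 | +-comm M 3
        | isFloorφ-unique (isFloorMulφ⇒isFloorφ q₁ φ-floor₁) (isFloorφ-after-fib M t≤F)
        | isFloorφ-unique (isFloorMulφ⇒isFloorφ q₂ φ-floor₂)
            (subst₂ IsFloorφ (+-identityʳ _) (+-identityʳ _) (isFloorφ-after-fib M z≤n))
  = a-formula M 1≤k h<k t≤F , b-formula M 1≤k h<k t≤F
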